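{- Let $q$ be an even power of $2$ and define $f\colon\mathbb{F}_q\to\mathbb{F}_q$ by $f(x):=x^3$. Then for every $t\in\mathbb{F}_q$, the set $I_f(t):=\{f(x)+tx:x\in\mathbb{F}_q\}$ satisfies $|I_f(t)|\le(2q+1)/3$.
   Context: $\mathbb{F}_q$ denotes the finite field with $q$ elements. -}

module Defs where

open import Level using (0ℓ)
open import Algebra.Bundles using (CommutativeRing)
open import Data.Nat using (ℕ)
open import Data.Fin using (Fin)
open import Data.List using (List; length; filter)
open import Data.List.Base using (allFin)
open import Data.List.Relation.Unary.Any using (Any; any?)
open import Data.Product using (∃)
open import Relation.Nullary using (¬_)
open import Relation.Binary.Definitions using (Decidable)
open import Relation.Binary.PropositionalEquality using (_≡_)

record FiniteField : Set₁ where
  field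
    commRing : CommutativeRing 0ℓ 0ℓ
  open CommutativeRing commRing public
  field
    0≉1       : ¬ (0# ≈ 1#)
    inverse   : ∀ x → ¬ (x ≈ 0#) → ∃ λ y → x * y ≈ 1#
    _≟_       : Decidable _≈_
    size      : ℕ
    enum      : Fin size → Carrier
    enum-inj  : ∀ i j → enum i ≈ enum j → i ≡ j
    enum-surj : ∀ x → ∃ λ i → enum i ≈ x

module _ (F : FiniteField) where
  open FiniteField F

  cube : Carrier → Carrier
  cube x = x * x * x

  inImage? : (t : Carrier) (i : Fin size) → _
  inImage? t i = any? (λ j → enum i ≟ (cube (enum j) + t * enum j)) (allFin size)

  -- |I_f(t)| : number of field elements (each counted once via the enumeration)
  -- of the form f(x) + t x
  imageSize : Carrier → ℕ
  imageSize t = length (filter (inImage? t) (allFin size))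

{-# OPTIONS --safe #-}
module Submission where

-- Let q = |F| = 4^k and h x = x³ + t x.  If 1 + 1 ≠ 0, pairing x with -x would make q - 1 even, so
-- F has characteristic 2.  Then z ↦ 1/(z + 1), a permutation of order 3 of F ∖ {0, 1}, has a fixed
-- point because q - 2 is not divisible by 3; that point is a root ω of X² + X + 1.
-- In characteristic 2, h x + h y = (x + y)(Q x y + t) with Q x y = x² + xy + y², so every fibre of h
-- has at most 3 points.  With S = Σ_y |h⁻¹(h y)|, a value with m preimages contributes m to S and
-- m(4 - m) ≥ 3 to 4q - S, whence 3 |h(F)| + S ≤ 4q.  On the other hand S - q counts the pairs
-- x ≠ y with Q x y = t.  As Q x y = (x + ωy)(x + ω̄y), the equation Q x y = t has at least q - 1
-- solutions, at most one of them on the diagonal (Q x x = x²), so S ≥ 2q - 2.  Hence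
-- 3 |h(F)| ≤ 2q + 2, and even 3 |h(F)| ≤ 2q + 1 since q ≡ 1 (mod 3).

open import Defs
open import Data.Nat using (ℕ; _+_; _*_; _^_; _≤_)
open import Relation.Binary.PropositionalEquality using (_≡_)

open import Level using (0ℓ)
open import Algebra.Bundles using (CommutativeRing)
open import Data.Nat using (zero; suc; _∸_; _<_; z≤n; s≤s; _≤?_; NonZero)
open import Data.Nat.Properties
  using ( +-*-semiring; module ≤-Reasoning; ≤-refl; ≤-trans; ≤-reflexive; ≤-antisym; <-irrefl; ≰⇒>
        ; m≤m+n; m≤n+m; n≤1+n; +-mono-≤; +-monoˡ-≤; +-monoʳ-≤; +-monoʳ-<; *-monoʳ-≤; +-cancelˡ-≤
        ; m∸n+n≡m)
import Data.Nat.Properties as ℕ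
open import Data.Nat.DivMod using (_%_; [m+kn]%n≡m%n; m*n%n≡0)
open import Data.Nat.Tactic.RingSolver using (solve-∀)
open import Data.Fin as Fin using (Fin; zero; suc)
import Data.Fin.Properties as Fin
open import Data.Fin.Permutation using (Permutation′; permutation)
open import Algebra.Properties.Semiring.Sum +-*-semiring
  using (sum; sum-cong-≗; sum-replicate-zero; ∑-comm; ∑-distrib-+; sum-permute; *-distribˡ-sum)
open import Data.List using (length; filter; allFin; tabulate)
open import Data.List.Relation.Unary.Any using (Any; any?; satisfied)
open import Data.Product using (∃; _,_; proj₁; proj₂; _×_)
open import Data.Sum using (_⊎_; inj₁; inj₂)
open import Data.Empty using (⊥-elim)
open import Function using (_∘_; id)
open import Function.Definitions using (Congruent)
open import Relation.Nullary using (Dec; yes; no; ¬_; ¬?; contradiction)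
open import Relation.Nullary.Decidable using (_×-dec_)
open import Relation.Unary using (Pred)
import Relation.Unary as Pred
open import Relation.Binary using (Rel; IsEquivalence; Decidable; _Respects_; tri<; tri≈; tri>)
import Relation.Binary.Reasoning.Setoid
open import Relation.Binary.PropositionalEquality
  using (_≢_; refl; sym; trans; cong; cong₂; subst₂; module ≡-Reasoning)

4^k≡1+m*3 : ∀ k → ∃ λ m → 4 ^ k ≡ 1 + m * 3
4^k≡1+m*3 zero    = 0 , refl
4^k≡1+m*3 (suc k) with 4^k≡1+m*3 k
... | m , 4^k≡ = 1 + 4 * m , trans (cong (4 *_) 4^k≡) (step m)
  where
  step : ∀ m → 4 * (1 + m * 3) ≡ 1 + (1 + 4 * m) * 3
  step = solve-∀

*-cancelˡ-≤-+ : ∀ k {a b r} .{{_ : NonZero k}} → r < k → k * a ≤ k * b + r → a ≤ b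
*-cancelˡ-≤-+ k {a} {b} {r} r<k ka≤kb+r with a ≤? b
... | yes a≤b = a≤b
... | no a≰b = contradiction (begin-strict
      k * suc b       ≤⟨ *-monoʳ-≤ k (≰⇒> a≰b) ⟩
      k * a           ≤⟨ ka≤kb+r ⟩
      k * b + r       <⟨ +-monoʳ-< (k * b) r<k ⟩
      k * b + k       ≡⟨ ℕ.+-comm (k * b) k ⟩
      k + k * b       ≡⟨ ℕ.*-suc k b ⟨
      k * suc b ∎) (<-irrefl refl)
  where open ≤-Reasoning

odd≢4^suc : ∀ m k → m + m + 1 ≢ 4 ^ suc k
odd≢4^suc m k eq = ℕ.1+n≢0 (begin
  1                      ≡⟨ [m+kn]%n≡m%n 1 m 2 ⟨
  (1 + m * 2) % 2        ≡⟨ cong (_% 2) (trans (odd m) eq) ⟩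
  (4 * 4 ^ k) % 2        ≡⟨ cong (_% 2) (even (4 ^ k)) ⟩
  (2 * 4 ^ k * 2) % 2    ≡⟨ m*n%n≡0 (2 * 4 ^ k) 2 ⟩
  0 ∎)
  where
  open ≡-Reasoning
  odd : ∀ m → 1 + m * 2 ≡ m + m + 1
  odd = solve-∀
  even : ∀ x → 4 * x ≡ 2 * x * 2
  even = solve-∀

2+3m≢4^k : ∀ m k → m + m + m + 2 ≢ 4 ^ k
2+3m≢4^k m k eq with 4^k≡1+m*3 k
... | j , 4^k≡ = ℕ.1+n≢n (begin
  2                      ≡⟨ [m+kn]%n≡m%n 2 m 3 ⟨
  (2 + m * 3) % 3        ≡⟨ cong (_% 3) (trans (rearrange m) (trans eq 4^k≡)) ⟩
  (1 + j * 3) % 3        ≡⟨ [m+kn]%n≡m%n 1 j 3 ⟩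
  1 ∎)
  where
  open ≡-Reasoning
  rearrange : ∀ m → 2 + m * 3 ≡ m + m + m + 2
  rearrange = solve-∀

image-size-arithmetic : ∀ i {s q} → 3 * i + s ≤ 4 * q → 2 * q ≤ s + 2 → ∃ (λ m → q ≡ 1 + m * 3) →
                        3 * i ≤ 2 * q + 1
image-size-arithmetic i {s} {q} upper lower (m , refl) = begin
  3 * i              ≤⟨ *-monoʳ-≤ 3 (*-cancelˡ-≤-+ 3 {i} {1 + m * 2} (s≤s (s≤s z≤n)) 3i≤) ⟩
  3 * (1 + m * 2)    ≡⟨ e₁ m ⟩
  2 * q + 1 ∎
  where
  open ≤-Reasoning
  e₁ : ∀ m → 3 * (1 + m * 2) ≡ 2 * (1 + m * 3) + 1
  e₁ = solve-∀
  e₂ : ∀ m → 4 * (1 + m * 3) + 2 ≡ 2 * (1 + m * 3) + (3 * (1 + m * 2) + 1)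
  e₂ = solve-∀
  3i≤ : 3 * i ≤ 3 * (1 + m * 2) + 1
  3i≤ = +-cancelˡ-≤ (2 * q) _ _ (begin
    2 * q + 3 * i                 ≡⟨ ℕ.+-comm (2 * q) (3 * i) ⟩
    3 * i + 2 * q                 ≤⟨ +-monoʳ-≤ (3 * i) lower ⟩
    3 * i + (s + 2)               ≡⟨ ℕ.+-assoc (3 * i) s 2 ⟨
    3 * i + s + 2                 ≤⟨ +-monoˡ-≤ 2 upper ⟩
    4 * q + 2                     ≡⟨ e₂ m ⟩
    2 * q + (3 * (1 + m * 2) + 1) ∎)

3≤[4∸m]*m : ∀ {m} → 1 ≤ m → m ≤ 3 → 3 ≤ (4 ∸ m) * m
3≤[4∸m]*m {1} _ _ = ≤-refl
3≤[4∸m]*m {2} _ _ = s≤s (s≤s (s≤s z≤n))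
3≤[4∸m]*m {3} _ _ = ≤-refl
3≤[4∸m]*m {suc (suc (suc (suc _)))} _ (s≤s (s≤s (s≤s ())))

𝟙 : {P : Set} → Dec P → ℕ
𝟙 (yes _) = 1
𝟙 (no _)  = 0

𝟙-mono : {P Q : Set} → (P → Q) → (p : Dec P) (q : Dec Q) → 𝟙 p ≤ 𝟙 q
𝟙-mono P⇒Q (yes p) (yes q) = ≤-refl
𝟙-mono P⇒Q (yes p) (no ¬q) = ⊥-elim (¬q (P⇒Q p))
𝟙-mono P⇒Q (no ¬p) q       = z≤n

𝟙-cong : {P Q : Set} → (P → Q) → (Q → P) → (p : Dec P) (q : Dec Q) → 𝟙 p ≡ 𝟙 q
𝟙-cong P⇒Q Q⇒P p q = ≤-antisym (𝟙-mono P⇒Q p q) (𝟙-mono Q⇒P q p)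

𝟙-yes : {P : Set} → P → (p : Dec P) → 𝟙 p ≡ 1
𝟙-yes _ (yes _) = refl
𝟙-yes p (no ¬p) = ⊥-elim (¬p p)

𝟙-no : {P : Set} → ¬ P → (p : Dec P) → 𝟙 p ≡ 0
𝟙-no ¬p (yes p) = ⊥-elim (¬p p)
𝟙-no _  (no _)  = refl

𝟙-¬ : {P : Set} (p : Dec P) → 𝟙 (¬? p) + 𝟙 p ≡ 1
𝟙-¬ (yes _) = refl
𝟙-¬ (no _)  = refl

𝟙-⊎₃ : {P Q R S : Set} → (P → Q ⊎ R ⊎ S) →
       (p : Dec P) (q : Dec Q) (r : Dec R) (s : Dec S) → 𝟙 p ≤ 𝟙 q + 𝟙 r + 𝟙 s
𝟙-⊎₃ cover (no _)  q r s = z≤n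
𝟙-⊎₃ cover (yes p) q r s with cover p
... | inj₁ x        = ≤-trans (≤-reflexive (sym (𝟙-yes x q))) (≤-trans (m≤m+n (𝟙 q) (𝟙 r)) (m≤m+n _ (𝟙 s)))
... | inj₂ (inj₁ x) = ≤-trans (≤-reflexive (sym (𝟙-yes x r))) (≤-trans (m≤n+m (𝟙 r) (𝟙 q)) (m≤m+n _ (𝟙 s)))
... | inj₂ (inj₂ x) = ≤-trans (≤-reflexive (sym (𝟙-yes x s))) (m≤n+m (𝟙 s) (𝟙 q + 𝟙 r))

sum-𝟙-≡ : ∀ {n} (j : Fin n) → sum (λ i → 𝟙 (i Fin.≟ j)) ≡ 1
sum-𝟙-≡ {suc n} zero = cong suc (trans (sum-cong-≗ {n} (λ i → 𝟙-no (λ ()) (suc i Fin.≟ zero)))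
                                        (sum-replicate-zero n))
sum-𝟙-≡ (suc j) = trans (sum-cong-≗ (λ i → 𝟙-cong Fin.suc-injective (cong suc) (suc i Fin.≟ suc j) (i Fin.≟ j)))
                        (sum-𝟙-≡ j)

length-filter-tabulate : ∀ {n} {A : Set} {P : Pred A 0ℓ} (P? : Pred.Decidable P) (f : Fin n → A) →
                         length (filter P? (tabulate f)) ≡ sum (λ i → 𝟙 (P? (f i)))
length-filter-tabulate {zero}  P? f = refl
length-filter-tabulate {suc n} P? f with P? (f zero)
... | yes _ = cong suc (length-filter-tabulate P? (f ∘ suc))
... | no _  = length-filter-tabulate P? (f ∘ suc)

sum-mono-≤ : ∀ {n} {f g : Fin n → ℕ} → (∀ i → f i ≤ g i) → sum f ≤ sum g
sum-mono-≤ {zero}  f≤g = z≤n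
sum-mono-≤ {suc n} f≤g = +-mono-≤ (f≤g zero) (sum-mono-≤ (f≤g ∘ suc))

sum-const : ∀ {n} c → sum {n} (λ _ → c) ≡ n * c
sum-const {zero}  c = refl
sum-const {suc n} c = cong (c +_) (sum-const {n} c)

cyclic-minimum : ∀ {n} {a b c : Fin n} → a ≢ b → b ≢ c → a ≢ c →
                 (p : Dec (a Fin.< b × a Fin.< c)) (q : Dec (b Fin.< c × b Fin.< a))
                 (r : Dec (c Fin.< a × c Fin.< b)) → 𝟙 p + 𝟙 q + 𝟙 r ≡ 1
cyclic-minimum _ _ _ (yes p) (yes q) _       = ⊥-elim (Fin.<-asym (proj₁ p) (proj₂ q))
cyclic-minimum _ _ _ (yes p) (no _)  (yes r) = ⊥-elim (Fin.<-asym (proj₂ p) (proj₁ r))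
cyclic-minimum _ _ _ (no _)  (yes q) (yes r) = ⊥-elim (Fin.<-asym (proj₁ q) (proj₂ r))
cyclic-minimum _ _ _ (yes _) (no _)  (no _)  = refl
cyclic-minimum _ _ _ (no _)  (yes _) (no _)  = refl
cyclic-minimum _ _ _ (no _)  (no _)  (yes _) = refl
cyclic-minimum {a = a} {b} {c} a≢b b≢c a≢c (no ¬p) (no ¬q) (no ¬r)
  with Fin.<-cmp a b | Fin.<-cmp b c | Fin.<-cmp a c
... | tri≈ _ a≡b _ | _ | _ = ⊥-elim (a≢b a≡b)
... | _ | tri≈ _ b≡c _ | _ = ⊥-elim (b≢c b≡c)
... | _ | _ | tri≈ _ a≡c _ = ⊥-elim (a≢c a≡c)
... | tri< a<b _ _ | _ | tri< a<c _ _ = ⊥-elim (¬p (a<b , a<c))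
... | tri> _ _ b<a | tri< b<c _ _ | _ = ⊥-elim (¬q (b<c , b<a))
... | _ | tri> _ _ c<b | tri> _ _ c<a = ⊥-elim (¬r (c<a , c<b))
... | tri< a<b _ _ | tri< b<c _ _ | tri> _ _ c<a = ⊥-elim (Fin.<-asym a<b (Fin.<-trans b<c c<a))
... | tri> _ _ b<a | tri> _ _ c<b | tri< a<c _ _ = ⊥-elim (Fin.<-asym a<c (Fin.<-trans c<b b<a))

module Counting
  {A : Set} {_≈_ : Rel A 0ℓ} (≈-isEquivalence : IsEquivalence _≈_) (_≟_ : Decidable _≈_)
  {n : ℕ} (enum : Fin n → A)
  (enum-injective : ∀ i j → enum i ≈ enum j → i ≡ j)
  (enum-surjective : ∀ x → ∃ λ i → enum i ≈ x)
  where

  open IsEquivalence ≈-isEquivalence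
    renaming (refl to ≈-refl; sym to ≈-sym; trans to ≈-trans; reflexive to ≈-reflexive)

  index : A → Fin n
  index x = proj₁ (enum-surjective x)

  enum-index : ∀ x → enum (index x) ≈ x
  enum-index x = proj₂ (enum-surjective x)

  index-cong : ∀ {x y} → x ≈ y → index x ≡ index y
  index-cong {x} {y} x≈y =
    enum-injective _ _ (≈-trans (enum-index x) (≈-trans x≈y (≈-sym (enum-index y))))

  index-enum : ∀ i → index (enum i) ≡ i
  index-enum i = enum-injective _ _ (enum-index (enum i))

  index-injective : ∀ {x y} → index x ≡ index y → x ≈ y
  index-injective {x} {y} eq =
    ≈-trans (≈-sym (enum-index x)) (≈-trans (≈-reflexive (cong enum eq)) (enum-index y))

  ∑ : (A → ℕ) → ℕ
  ∑ f = sum (f ∘ enum)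

  syntax ∑ (λ x → e) = ∑[ x ] e

  count : {P : Pred A 0ℓ} → Pred.Decidable P → ℕ
  count P? = ∑[ x ] 𝟙 (P? x)

  ∑-cong : {f g : A → ℕ} → (∀ x → f x ≡ g x) → ∑ f ≡ ∑ g
  ∑-cong f≗g = sum-cong-≗ (f≗g ∘ enum)

  ∑-mono-≤ : {f g : A → ℕ} → (∀ x → f x ≤ g x) → ∑ f ≤ ∑ g
  ∑-mono-≤ f≤g = sum-mono-≤ (f≤g ∘ enum)

  ∑-+ : (f g : A → ℕ) → ∑[ x ] (f x + g x) ≡ ∑ f + ∑ g
  ∑-+ f g = ∑-distrib-+ (f ∘ enum) (g ∘ enum)

  ∑-*ˡ : (c : ℕ) (f : A → ℕ) → ∑[ x ] (c * f x) ≡ c * ∑ f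
  ∑-*ˡ c f = sym (*-distribˡ-sum c (f ∘ enum))

  ∑-const : (c : ℕ) → ∑[ x ] c ≡ n * c
  ∑-const = sum-const {n}

  ∑-swap : (f : A → A → ℕ) → ∑[ x ] ∑[ y ] f x y ≡ ∑[ y ] ∑[ x ] f x y
  ∑-swap f = ∑-comm (λ i j → f (enum i) (enum j))

  ∑-reindex : (φ ψ : A → A) → Congruent _≈_ _≈_ φ → Congruent _≈_ _≈_ ψ →
              (∀ x → φ (ψ x) ≈ x) → (∀ x → ψ (φ x) ≈ x) →
              (f : A → ℕ) → Congruent _≈_ _≡_ f → ∑ f ≡ ∑ (f ∘ φ)
  ∑-reindex φ ψ φ-cong ψ-cong φψ ψφ f f-cong =
    trans (sum-permute (f ∘ enum) π) (∑-cong (λ x → f-cong (enum-index (φ x))))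
    where
    π : Permutation′ n
    π = permutation (index ∘ φ ∘ enum) (index ∘ ψ ∘ enum)
          (λ j → trans (index-cong (≈-trans (φ-cong (enum-index (ψ (enum j)))) (φψ (enum j)))) (index-enum j))
          (λ i → trans (index-cong (≈-trans (ψ-cong (enum-index (φ (enum i)))) (ψφ (enum i)))) (index-enum i))

  ∑-1 : ∑[ x ] 1 ≡ n
  ∑-1 = trans (∑-const 1) (ℕ.*-identityʳ n)

  count-≈ : ∀ a → count (_≟ a) ≡ 1
  count-≈ a = trans (sum-cong-≗ λ i → 𝟙-cong (λ i≈a → enum-injective _ _ (≈-trans i≈a (≈-sym (enum-index a))))
                                              (λ i≡ → ≈-trans (≈-reflexive (cong enum i≡)) (enum-index a))
                                              (enum i ≟ a) (i Fin.≟ index a))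
                    (sum-𝟙-≡ (index a))

  count-≉ : ∀ a → count (λ x → ¬? (x ≟ a)) + 1 ≡ n
  count-≉ a = begin
    count (λ x → ¬? (x ≟ a)) + 1               ≡⟨ cong (count (λ x → ¬? (x ≟ a)) +_) (count-≈ a) ⟨
    count (λ x → ¬? (x ≟ a)) + count (_≟ a)    ≡⟨ ∑-+ (λ x → 𝟙 (¬? (x ≟ a))) (λ x → 𝟙 (x ≟ a)) ⟨
    ∑[ x ] (𝟙 (¬? (x ≟ a)) + 𝟙 (x ≟ a))        ≡⟨ ∑-cong (λ x → 𝟙-¬ (x ≟ a)) ⟩
    ∑[ x ] 1                                   ≡⟨ ∑-1 ⟩
    n ∎
    where open ≡-Reasoning

  ∑-𝟙-≈-* : ∀ a c → ∑[ x ] (𝟙 (x ≟ a) * c) ≡ c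
  ∑-𝟙-≈-* a c = begin
    ∑[ x ] (𝟙 (x ≟ a) * c)    ≡⟨ ∑-cong (λ x → ℕ.*-comm (𝟙 (x ≟ a)) c) ⟩
    ∑[ x ] (c * 𝟙 (x ≟ a))    ≡⟨ ∑-*ˡ c (λ x → 𝟙 (x ≟ a)) ⟩
    c * count (_≟ a)          ≡⟨ cong (c *_) (count-≈ a) ⟩
    c * 1                     ≡⟨ ℕ.*-identityʳ c ⟩
    c ∎
    where open ≡-Reasoning

  count-≉₂ : ∀ {a b} → ¬ a ≈ b → count (λ x → ¬? (x ≟ a) ×-dec ¬? (x ≟ b)) + 2 ≡ n
  count-≉₂ {a} {b} a≉b = begin
    count (λ x → ¬? (x ≟ a) ×-dec ¬? (x ≟ b)) + 2
      ≡⟨ cong (count (λ x → ¬? (x ≟ a) ×-dec ¬? (x ≟ b)) +_) (cong₂ _+_ (count-≈ a) (count-≈ b)) ⟨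
    count (λ x → ¬? (x ≟ a) ×-dec ¬? (x ≟ b)) + (count (_≟ a) + count (_≟ b))
      ≡⟨ cong (count (λ x → ¬? (x ≟ a) ×-dec ¬? (x ≟ b)) +_) (∑-+ (λ x → 𝟙 (x ≟ a)) (λ x → 𝟙 (x ≟ b))) ⟨
    count (λ x → ¬? (x ≟ a) ×-dec ¬? (x ≟ b)) + ∑[ x ] (𝟙 (x ≟ a) + 𝟙 (x ≟ b))
      ≡⟨ ∑-+ (λ x → 𝟙 (¬? (x ≟ a) ×-dec ¬? (x ≟ b))) (λ x → 𝟙 (x ≟ a) + 𝟙 (x ≟ b)) ⟨
    ∑[ x ] (𝟙 (¬? (x ≟ a) ×-dec ¬? (x ≟ b)) + (𝟙 (x ≟ a) + 𝟙 (x ≟ b)))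
      ≡⟨ ∑-cong (λ x → partition (x ≟ a) (x ≟ b)) ⟩
    ∑[ x ] 1
      ≡⟨ ∑-1 ⟩
    n ∎
    where
    open ≡-Reasoning
    partition : ∀ {x} (p : Dec (x ≈ a)) (q : Dec (x ≈ b)) → 𝟙 (¬? p ×-dec ¬? q) + (𝟙 p + 𝟙 q) ≡ 1
    partition (yes x≈a) (yes x≈b) = ⊥-elim (a≉b (≈-trans (≈-sym x≈a) x≈b))
    partition (yes _)   (no _)    = refl
    partition (no _)    (yes _)   = refl
    partition (no _)    (no _)    = refl

  module _ {P : Pred A 0ℓ} (P? : Pred.Decidable P) where

    count-≥1 : P Respects _≈_ → ∀ {a} → P a → 1 ≤ count P?
    count-≥1 resp {a} Pa = ≤-trans (≤-reflexive (sym (count-≈ a)))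
                                   (∑-mono-≤ (λ x → 𝟙-mono (λ x≈a → resp (≈-sym x≈a) Pa) (x ≟ a) (P? x)))

    count-≤1 : (∀ {x y} → P x → P y → x ≈ y) → count P? ≤ 1
    count-≤1 unique with Fin.any? (P? ∘ enum)
    ... | yes (i , Pi) = ≤-trans (∑-mono-≤ (λ x → 𝟙-mono (λ Px → unique Px Pi) (P? x) (x ≟ enum i)))
                                 (≤-reflexive (count-≈ (enum i)))
    ... | no ¬∃P       = ≤-trans (≤-reflexive (trans (sum-cong-≗ (λ i → 𝟙-no (λ Pi → ¬∃P (i , Pi)) (P? (enum i))))
                                                     (sum-replicate-zero n)))
                                 z≤n

    count-≤3 : ∀ {a b c} → (∀ {x} → P x → x ≈ a ⊎ x ≈ b ⊎ x ≈ c) → count P? ≤ 3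
    count-≤3 {a} {b} {c} cover = begin
      count P?
        ≤⟨ ∑-mono-≤ (λ x → 𝟙-⊎₃ cover (P? x) (x ≟ a) (x ≟ b) (x ≟ c)) ⟩
      ∑[ x ] (𝟙 (x ≟ a) + 𝟙 (x ≟ b) + 𝟙 (x ≟ c))
        ≡⟨ ∑-+ (λ x → 𝟙 (x ≟ a) + 𝟙 (x ≟ b)) (λ x → 𝟙 (x ≟ c)) ⟩
      ∑[ x ] (𝟙 (x ≟ a) + 𝟙 (x ≟ b)) + count (_≟ c)
        ≡⟨ cong (_+ count (_≟ c)) (∑-+ (λ x → 𝟙 (x ≟ a)) (λ x → 𝟙 (x ≟ b))) ⟩
      count (_≟ a) + count (_≟ b) + count (_≟ c)
        ≡⟨ cong₂ _+_ (cong₂ _+_ (count-≈ a) (count-≈ b)) (count-≈ c) ⟩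
      3 ∎
      where open ≤-Reasoning

  -- Enumeration order; it singles out one point in every orbit of a permutation.
  _≺_ : Rel A 0ℓ
  x ≺ y = index x Fin.< index y

  _≺?_ : Decidable _≺_
  x ≺? y = index x Fin.<? index y

  ≺-resp : ∀ {x x′ y y′} → x ≈ x′ → y ≈ y′ → x ≺ y → x′ ≺ y′
  ≺-resp x≈x′ y≈y′ = subst₂ Fin._<_ (index-cong x≈x′) (index-cong y≈y′)

  module _ {D : Pred A 0ℓ} (D? : Pred.Decidable D) (D-resp : D Respects _≈_)
           (φ : A → A) (φ-cong : Congruent _≈_ _≈_ φ)
           (D-φ : ∀ {x} → D x → D (φ x)) (φ-fixless : ∀ {x} → D x → ¬ φ x ≈ x)
           where

    count-even-by-involution : (∀ x → φ (φ x) ≈ x) → ∃ λ m → count D? ≡ m + m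
    count-even-by-involution φφ = count first? , (begin
      count D?                                   ≡⟨ ∑-cong split ⟩
      ∑[ x ] (𝟙 (first? x) + 𝟙 (second? x))      ≡⟨ ∑-+ (𝟙 ∘ first?) (𝟙 ∘ second?) ⟩
      count first? + count second?               ≡⟨ cong (count first? +_) second≡first ⟩
      count first? + count first? ∎)
      where
      open ≡-Reasoning
      first? : Pred.Decidable (λ x → D x × x ≺ φ x)
      first? x = D? x ×-dec (x ≺? φ x)
      second? : Pred.Decidable (λ x → D x × φ x ≺ x)
      second? x = D? x ×-dec (φ x ≺? x)

      split : ∀ x → 𝟙 (D? x) ≡ 𝟙 (first? x) + 𝟙 (second? x)
      split x = by-cases (D? x)
        where
        by-cases : Dec (D x) → 𝟙 (D? x) ≡ 𝟙 (first? x) + 𝟙 (second? x)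
        by-cases (no ¬Dx) = trans (𝟙-no ¬Dx (D? x))
                                  (sym (cong₂ _+_ (𝟙-no (¬Dx ∘ proj₁) (first? x)) (𝟙-no (¬Dx ∘ proj₁) (second? x))))
        by-cases (yes Dx) with Fin.<-cmp (index x) (index (φ x))
        ... | tri< x≺φx _ _ = trans (𝟙-yes Dx (D? x))
                                    (sym (cong₂ _+_ (𝟙-yes (Dx , x≺φx) (first? x))
                                                    (𝟙-no (Fin.<-asym x≺φx ∘ proj₂) (second? x))))
        ... | tri≈ _ x≡φx _ = ⊥-elim (φ-fixless Dx (≈-sym (index-injective x≡φx)))
        ... | tri> _ _ φx≺x = trans (𝟙-yes Dx (D? x))
                                    (sym (cong₂ _+_ (𝟙-no (Fin.<-asym φx≺x ∘ proj₂) (first? x))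
                                                    (𝟙-yes (Dx , φx≺x) (second? x))))

      second≡first : count second? ≡ count first?
      second≡first = trans (∑-reindex φ φ φ-cong φ-cong φφ φφ (𝟙 ∘ second?) second-cong)
                           (∑-cong λ x → 𝟙-cong (second-φ⇒first x) (first⇒second-φ x) (second? (φ x)) (first? x))
        where
        second-cong : Congruent _≈_ _≡_ (𝟙 ∘ second?)
        second-cong x≈y = 𝟙-cong (transport x≈y) (transport (≈-sym x≈y)) (second? _) (second? _)
          where
          transport : ∀ {x y} → x ≈ y → D x × φ x ≺ x → D y × φ y ≺ y
          transport x≈y (Dx , φx≺x) = D-resp x≈y Dx , ≺-resp (φ-cong x≈y) x≈y φx≺x
        second-φ⇒first : ∀ x → D (φ x) × φ (φ x) ≺ φ x → D x × x ≺ φ x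
        second-φ⇒first x (Dφx , φφx≺φx) = D-resp (φφ x) (D-φ Dφx) , ≺-resp (φφ x) ≈-refl φφx≺φx
        first⇒second-φ : ∀ x → D x × x ≺ φ x → D (φ x) × φ (φ x) ≺ φ x
        first⇒second-φ x (Dx , x≺φx) = D-φ Dx , ≺-resp (≈-sym (φφ x)) ≈-refl x≺φx

    module _ (D-φ⁻ : ∀ {x} → D (φ x) → D x) (φ³ : ∀ {x} → D x → φ (φ (φ x)) ≈ x) where

      least? : Pred.Decidable (λ x → D x × x ≺ φ x × x ≺ φ (φ x))
      least? x = D? x ×-dec (x ≺? φ x ×-dec x ≺? φ (φ x))

      least-cong : Congruent _≈_ _≡_ (𝟙 ∘ least?)
      least-cong x≈y = 𝟙-cong (transport x≈y) (transport (≈-sym x≈y)) (least? _) (least? _)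
        where
        transport : ∀ {x y} → x ≈ y → D x × x ≺ φ x × x ≺ φ (φ x) → D y × y ≺ φ y × y ≺ φ (φ y)
        transport x≈y (Dx , x≺φx , x≺φφx) =
          D-resp x≈y Dx , ≺-resp x≈y (φ-cong x≈y) x≺φx , ≺-resp x≈y (φ-cong (φ-cong x≈y)) x≺φφx

      one-least-per-orbit : ∀ {x} → D x → 𝟙 (least? x) + 𝟙 (least? (φ x)) + 𝟙 (least? (φ (φ x))) ≡ 1
      one-least-per-orbit {x} Dx = begin
        𝟙 (least? x) + 𝟙 (least? (φ x)) + 𝟙 (least? (φ (φ x)))
          ≡⟨ cong₂ _+_ (cong₂ _+_ least-x least-φx) least-φφx ⟩
        𝟙 (x ≺? φ x ×-dec x ≺? φ (φ x)) + 𝟙 (φ x ≺? φ (φ x) ×-dec φ x ≺? x)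
          + 𝟙 (φ (φ x) ≺? x ×-dec φ (φ x) ≺? φ x)
          ≡⟨ cyclic-minimum (φ-fixless Dx ∘ ≈-sym ∘ index-injective)
                            (φ-fixless (D-φ Dx) ∘ ≈-sym ∘ index-injective)
                            (λ eq → φ-fixless Dx (≈-trans (φ-cong (index-injective eq)) φ³x≈x))
                            (x ≺? φ x ×-dec x ≺? φ (φ x)) (φ x ≺? φ (φ x) ×-dec φ x ≺? x)
                            (φ (φ x) ≺? x ×-dec φ (φ x) ≺? φ x) ⟩
        1 ∎
        where
        open ≡-Reasoning
        φ³x≈x : φ (φ (φ x)) ≈ x
        φ³x≈x = φ³ Dx
        φ⁴x≈φx : φ (φ (φ (φ x))) ≈ φ x
        φ⁴x≈φx = φ-cong φ³x≈x
        least-x : 𝟙 (least? x) ≡ 𝟙 (x ≺? φ x ×-dec x ≺? φ (φ x))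
        least-x = 𝟙-cong proj₂ (Dx ,_) _ _
        least-φx : 𝟙 (least? (φ x)) ≡ 𝟙 (φ x ≺? φ (φ x) ×-dec φ x ≺? x)
        least-φx = 𝟙-cong (λ (_ , l₁ , l₂) → l₁ , ≺-resp ≈-refl φ³x≈x l₂)
                          (λ (l₁ , l₂) → D-φ Dx , l₁ , ≺-resp ≈-refl (≈-sym φ³x≈x) l₂) _ _
        least-φφx : 𝟙 (least? (φ (φ x))) ≡ 𝟙 (φ (φ x) ≺? x ×-dec φ (φ x) ≺? φ x)
        least-φφx = 𝟙-cong (λ (_ , l₁ , l₂) → ≺-resp ≈-refl φ³x≈x l₁ , ≺-resp ≈-refl φ⁴x≈φx l₂)
                           (λ (l₁ , l₂) → D-φ (D-φ Dx) , ≺-resp ≈-refl (≈-sym φ³x≈x) l₁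
                                                      , ≺-resp ≈-refl (≈-sym φ⁴x≈φx) l₂) _ _

      split : ∀ x → 𝟙 (D? x) ≡ 𝟙 (least? x) + 𝟙 (least? (φ x)) + 𝟙 (least? (φ (φ x)))
      split x = by-cases (D? x)
        where
        by-cases : Dec (D x) → 𝟙 (D? x) ≡ 𝟙 (least? x) + 𝟙 (least? (φ x)) + 𝟙 (least? (φ (φ x)))
        by-cases (yes Dx) = trans (𝟙-yes Dx (D? x)) (sym (one-least-per-orbit Dx))
        by-cases (no ¬Dx) = trans (𝟙-no ¬Dx (D? x)) (sym (cong₂ _+_ (cong₂ _+_
          (𝟙-no (¬Dx ∘ proj₁) (least? x))
          (𝟙-no (¬Dx ∘ D-φ⁻ ∘ proj₁) (least? (φ x))))
          (𝟙-no (¬Dx ∘ D-φ⁻ ∘ D-φ⁻ ∘ proj₁) (least? (φ (φ x))))))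

      count-triple-by-order-three :
        (ψ : A → A) → Congruent _≈_ _≈_ ψ → (∀ x → φ (ψ x) ≈ x) → (∀ x → ψ (φ x) ≈ x) →
        ∃ λ m → count D? ≡ m + m + m
      count-triple-by-order-three ψ ψ-cong φψ ψφ = count least? , (begin
        count D?
          ≡⟨ ∑-cong split ⟩
        ∑[ x ] (𝟙 (least? x) + 𝟙 (least? (φ x)) + 𝟙 (least? (φ (φ x))))
          ≡⟨ ∑-+ (λ x → 𝟙 (least? x) + 𝟙 (least? (φ x))) (λ x → 𝟙 (least? (φ (φ x)))) ⟩
        ∑[ x ] (𝟙 (least? x) + 𝟙 (least? (φ x))) + ∑[ x ] 𝟙 (least? (φ (φ x)))
          ≡⟨ cong (_+ ∑[ x ] 𝟙 (least? (φ (φ x)))) (∑-+ (𝟙 ∘ least?) (λ x → 𝟙 (least? (φ x)))) ⟩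
        count least? + ∑[ x ] 𝟙 (least? (φ x)) + ∑[ x ] 𝟙 (least? (φ (φ x)))
          ≡⟨ cong₂ (λ a b → count least? + a + b) (sym M≡M∘φ) (sym (trans M≡M∘φ M∘φ≡M∘φ²)) ⟩
        count least? + count least? + count least? ∎)
        where
        open ≡-Reasoning
        reindex : (f : A → ℕ) → Congruent _≈_ _≡_ f → ∑ f ≡ ∑ (f ∘ φ)
        reindex = ∑-reindex φ ψ φ-cong ψ-cong φψ ψφ
        M≡M∘φ : count least? ≡ ∑[ x ] 𝟙 (least? (φ x))
        M≡M∘φ = reindex (𝟙 ∘ least?) least-cong
        M∘φ≡M∘φ² : ∑[ x ] 𝟙 (least? (φ x)) ≡ ∑[ x ] 𝟙 (least? (φ (φ x)))
        M∘φ≡M∘φ² = reindex (𝟙 ∘ least? ∘ φ) (least-cong ∘ φ-cong)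

  module _ (h : A → A) where

    fibreSize : A → ℕ
    fibreSize y = count (λ z → h y ≟ h z)

    fibreSize-cong : ∀ {y y′} → h y ≈ h y′ → fibreSize y ≡ fibreSize y′
    fibreSize-cong {y} {y′} hy≈hy′ =
      ∑-cong λ z → 𝟙-cong (≈-trans (≈-sym hy≈hy′)) (≈-trans hy≈hy′) (h y ≟ h z) (h y′ ≟ h z)

    image-bound : Congruent _≈_ _≈_ h →
                  {I : Pred A 0ℓ} (I? : Pred.Decidable I) → (∀ {b} → I b → ∃ λ a → b ≈ h a) →
                  (∀ y → fibreSize y ≤ 3) → 3 * count I? + ∑ fibreSize ≤ 4 * n
    image-bound h-cong I? I⊆image fibre≤3 = begin
      3 * count I? + ∑ fibreSize                ≤⟨ +-monoˡ-≤ (∑ fibreSize) weights ⟩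
      ∑[ y ] (4 ∸ fibreSize y) + ∑ fibreSize    ≡⟨ ∑-+ (λ y → 4 ∸ fibreSize y) fibreSize ⟨
      ∑[ y ] (4 ∸ fibreSize y + fibreSize y)    ≡⟨ ∑-cong (λ y → m∸n+n≡m (≤-trans (fibre≤3 y) (n≤1+n 3))) ⟩
      ∑[ y ] 4                                  ≡⟨ ∑-const 4 ⟩
      n * 4                                     ≡⟨ ℕ.*-comm n 4 ⟩
      4 * n ∎
      where
      open ≤-Reasoning
      -- If the fibre over b has m ∈ {1, 2, 3} points, then W b = m (4 - m) ≥ 3.
      W : A → ℕ
      W b = ∑[ y ] (𝟙 (b ≟ h y) * (4 ∸ fibreSize y))

      W-cong : ∀ {b b′} → b ≈ b′ → W b ≡ W b′
      W-cong {b} {b′} b≈b′ = ∑-cong λ y →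
        cong (_* (4 ∸ fibreSize y)) (𝟙-cong (≈-trans (≈-sym b≈b′)) (≈-trans b≈b′) (b ≟ h y) (b′ ≟ h y))

      W-image : ∀ a → W (h a) ≡ (4 ∸ fibreSize a) * fibreSize a
      W-image a = trans (∑-cong {g = λ y → (4 ∸ fibreSize a) * 𝟙 (h a ≟ h y)} term)
                        (∑-*ˡ (4 ∸ fibreSize a) (λ y → 𝟙 (h a ≟ h y)))
        where
        term : ∀ y → 𝟙 (h a ≟ h y) * (4 ∸ fibreSize y) ≡ (4 ∸ fibreSize a) * 𝟙 (h a ≟ h y)
        term y with h a ≟ h y
        ... | yes ha≈hy = trans (ℕ.+-identityʳ _)
                                (trans (cong (4 ∸_) (fibreSize-cong (≈-sym ha≈hy))) (sym (ℕ.*-identityʳ _)))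
        ... | no _      = sym (ℕ.*-zeroʳ (4 ∸ fibreSize a))

      weight : ∀ b → 3 * 𝟙 (I? b) ≤ W b
      weight b with I? b
      ... | no _ = z≤n
      ... | yes Ib with I⊆image Ib
      ...   | a , b≈ha = begin
        3                                  ≤⟨ 3≤[4∸m]*m (count-≥1 (λ z → h a ≟ h z) fibre-resp ≈-refl) (fibre≤3 a) ⟩
        (4 ∸ fibreSize a) * fibreSize a    ≡⟨ W-image a ⟨
        W (h a)                            ≡⟨ W-cong b≈ha ⟨
        W b ∎
        where
        fibre-resp : (λ z → h a ≈ h z) Respects _≈_
        fibre-resp y≈z ha≈hy = ≈-trans ha≈hy (h-cong y≈z)

      weights : 3 * count I? ≤ ∑[ y ] (4 ∸ fibreSize y)
      weights = begin
        3 * count I?                 ≡⟨ ∑-*ˡ 3 (𝟙 ∘ I?) ⟨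
        ∑[ b ] (3 * 𝟙 (I? b))        ≤⟨ ∑-mono-≤ weight ⟩
        ∑ W                          ≡⟨ ∑-swap (λ b y → 𝟙 (b ≟ h y) * (4 ∸ fibreSize y)) ⟩
        ∑[ y ] ∑[ b ] (𝟙 (b ≟ h y) * (4 ∸ fibreSize y))
          ≡⟨ ∑-cong (λ y → ∑-𝟙-≈-* (h y) (4 ∸ fibreSize y)) ⟩
        ∑[ y ] (4 ∸ fibreSize y) ∎

  pair-bound : {E Q : A → A → Set} (E? : ∀ x → Pred.Decidable (E x)) (Q? : ∀ x → Pred.Decidable (Q x))
               {Z : Pred A 0ℓ} (Z? : Pred.Decidable Z) →
               (∀ {x y} → y ≈ x → E x y) → (∀ {x y} → Q x y → E x y) →
               (∀ {x y} → y ≈ x → Q x y → Z x) →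
               n + ∑[ x ] count (Q? x) ≤ ∑[ x ] count (E? x) + count Z?
  pair-bound {E} {Q} E? Q? {Z} Z? E-reflexive Q⊆E Q-on-diagonal = begin
    n + ∑[ x ] count (Q? x)
      ≡⟨ cong (_+ ∑[ x ] count (Q? x)) ∑-1 ⟨
    ∑[ x ] 1 + ∑[ x ] count (Q? x)
      ≡⟨ ∑-+ (λ _ → 1) (λ x → count (Q? x)) ⟨
    ∑[ x ] (1 + count (Q? x))
      ≡⟨ ∑-cong (λ x → cong (_+ count (Q? x)) (count-≈ x)) ⟨
    ∑[ x ] (count (_≟ x) + count (Q? x))
      ≡⟨ ∑-cong (λ x → ∑-+ (λ y → 𝟙 (y ≟ x)) (λ y → 𝟙 (Q? x y))) ⟨
    ∑[ x ] ∑[ y ] (𝟙 (y ≟ x) + 𝟙 (Q? x y))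
      ≤⟨ ∑-mono-≤ (λ x → ∑-mono-≤ (λ y → pointwise (y ≟ x) (Q? x y) (E? x y) (Z? x))) ⟩
    ∑[ x ] ∑[ y ] (𝟙 (E? x y) + 𝟙 (y ≟ x) * 𝟙 (Z? x))
      ≡⟨ ∑-cong (λ x → ∑-+ (λ y → 𝟙 (E? x y)) (λ y → 𝟙 (y ≟ x) * 𝟙 (Z? x))) ⟩
    ∑[ x ] (count (E? x) + ∑[ y ] (𝟙 (y ≟ x) * 𝟙 (Z? x)))
      ≡⟨ ∑-cong (λ x → cong (count (E? x) +_) (∑-𝟙-≈-* x (𝟙 (Z? x)))) ⟩
    ∑[ x ] (count (E? x) + 𝟙 (Z? x))
      ≡⟨ ∑-+ (λ x → count (E? x)) (𝟙 ∘ Z?) ⟩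
    ∑[ x ] count (E? x) + count Z? ∎
    where
    open ≤-Reasoning
    pointwise : ∀ {x y} (y≈x : Dec (y ≈ x)) (q : Dec (Q x y)) (e : Dec (E x y)) (z : Dec (Z x)) →
                𝟙 y≈x + 𝟙 q ≤ 𝟙 e + 𝟙 y≈x * 𝟙 z
    pointwise (yes _)   (yes _) (yes _) (yes _) = ≤-refl
    pointwise (yes y≈x) _       (no ¬e) _       = ⊥-elim (¬e (E-reflexive y≈x))
    pointwise (yes y≈x) (yes q) _       (no ¬z) = ⊥-elim (¬z (Q-on-diagonal y≈x q))
    pointwise (yes _)   (no _)  (yes _) _       = s≤s z≤n
    pointwise (no _)    (yes q) (no ¬e) _       = ⊥-elim (¬e (Q⊆E q))
    pointwise (no _)    (yes _) (yes _) _       = s≤s z≤n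
    pointwise (no _)    (no _)  _       _       = z≤n

HasCharacteristicTwo : CommutativeRing 0ℓ 0ℓ → Set
HasCharacteristicTwo R = 1# ⊕ 1# ≈ 0#
  where open CommutativeRing R renaming (_+_ to _⊕_)

IsPrimitiveCubeRoot : (R : CommutativeRing 0ℓ 0ℓ) → CommutativeRing.Carrier R → Set
IsPrimitiveCubeRoot R ω = ω ⊗ ω ⊕ ω ⊕ 1# ≈ 0#
  where open CommutativeRing R renaming (_+_ to _⊕_; _*_ to _⊗_)

module CharacteristicTwo (R : CommutativeRing 0ℓ 0ℓ) (char₂ : HasCharacteristicTwo R) where

  open CommutativeRing R
    renaming (_+_ to _⊕_; _*_ to _⊗_; refl to ≈-refl; sym to ≈-sym; trans to ≈-trans)
  open import Algebra.Solver.Ring.NaturalCoefficients.Default commutativeSemiring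
  open import Relation.Binary.Reasoning.Setoid setoid

  double≈0 : ∀ c → (1# ⊕ 1#) ⊗ c ≈ 0#
  double≈0 c = ≈-trans (*-congʳ char₂) (zeroˡ c)

  -- Ring identities are verified by the solver in the form a + 2c = b + 2d and then reduced to a = b.

  cancel-doubles : ∀ {a b} c d → a ⊕ (1# ⊕ 1#) ⊗ c ≈ b ⊕ (1# ⊕ 1#) ⊗ d → a ≈ b
  cancel-doubles {a} {b} c d eq = begin
    a                      ≈⟨ +-identityʳ a ⟨
    a ⊕ 0#                 ≈⟨ +-congˡ (double≈0 c) ⟨
    a ⊕ (1# ⊕ 1#) ⊗ c      ≈⟨ eq ⟩
    b ⊕ (1# ⊕ 1#) ⊗ d      ≈⟨ +-congˡ (double≈0 d) ⟩
    b ⊕ 0#                 ≈⟨ +-identityʳ b ⟩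
    b ∎

  x⊕x≈0 : ∀ x → x ⊕ x ≈ 0#
  x⊕x≈0 x = cancel-doubles 0# x
    (solve 1 (λ x → x :+ x :+ (con 1 :+ con 1) :* con 0 := con 0 :+ (con 1 :+ con 1) :* x) ≈-refl x)

  ⊕-cancelʳ : ∀ a b → a ⊕ b ⊕ b ≈ a
  ⊕-cancelʳ a b = ≈-trans (+-assoc a b b) (≈-trans (+-congˡ (x⊕x≈0 b)) (+-identityʳ a))

  ⊕≈0⇒≈ : ∀ {a b} → a ⊕ b ≈ 0# → a ≈ b
  ⊕≈0⇒≈ {a} {b} a⊕b≈0 = ≈-trans (≈-sym (⊕-cancelʳ a b)) (≈-trans (+-congʳ a⊕b≈0) (+-identityˡ b))

  ≈⇒⊕≈0 : ∀ {a b} → a ≈ b → a ⊕ b ≈ 0#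
  ≈⇒⊕≈0 {a} {b} a≈b = ≈-trans (+-congʳ a≈b) (x⊕x≈0 b)

  square-⊕ : ∀ x y → (x ⊕ y) ⊗ (x ⊕ y) ≈ x ⊗ x ⊕ y ⊗ y
  square-⊕ x y = cancel-doubles 0# (x ⊗ y)
    (solve 2 (λ x y → (x :+ y) :* (x :+ y) :+ (con 1 :+ con 1) :* con 0
                      := x :* x :+ y :* y :+ (con 1 :+ con 1) :* (x :* y)) ≈-refl x y)

  Q : Carrier → Carrier → Carrier
  Q x y = x ⊗ x ⊕ x ⊗ y ⊕ y ⊗ y

  Q-cong : ∀ {x x′ y y′} → x ≈ x′ → y ≈ y′ → Q x y ≈ Q x′ y′
  Q-cong x≈ y≈ = +-cong (+-cong (*-cong x≈ x≈) (*-cong x≈ y≈)) (*-cong y≈ y≈)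

  Q-diagonal : ∀ x → Q x x ≈ x ⊗ x
  Q-diagonal x = ≈-trans (+-congʳ (x⊕x≈0 (x ⊗ x))) (+-identityˡ (x ⊗ x))

  cubic-difference : ∀ t x y → x ⊗ x ⊗ x ⊕ t ⊗ x ⊕ (y ⊗ y ⊗ y ⊕ t ⊗ y) ≈ (x ⊕ y) ⊗ (Q x y ⊕ t)
  cubic-difference t x y = cancel-doubles (x ⊗ x ⊗ y ⊕ x ⊗ y ⊗ y) 0#
    (solve 3 (λ x y t → x :* x :* x :+ t :* x :+ (y :* y :* y :+ t :* y)
                         :+ (con 1 :+ con 1) :* (x :* x :* y :+ x :* y :* y)
                      := (x :+ y) :* (x :* x :+ x :* y :+ y :* y :+ t) :+ (con 1 :+ con 1) :* con 0) ≈-refl x y t)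

  Q-difference : ∀ x y z → Q y x ⊕ Q z x ≈ (y ⊕ z) ⊗ (y ⊕ z ⊕ x)
  Q-difference x y z = cancel-doubles (y ⊗ z) (x ⊗ x)
    (solve 3 (λ x y z → y :* y :+ y :* x :+ x :* x :+ (z :* z :+ z :* x :+ x :* x) :+ (con 1 :+ con 1) :* (y :* z)
                      := (y :+ z) :* (y :+ z :+ x) :+ (con 1 :+ con 1) :* (x :* x)) ≈-refl x y z)

  module CubeRootCoordinates (ω : Carrier) (ω-root : IsPrimitiveCubeRoot R ω) where

    ω̄ : Carrier
    ω̄ = ω ⊕ 1#

    ω⊗ω̄≈1 : ω ⊗ ω̄ ≈ 1#
    ω⊗ω̄≈1 = ≈-trans (solve 1 (λ ω → ω :* (ω :+ con 1) := ω :* ω :+ ω) ≈-refl ω) (⊕≈0⇒≈ ω-root)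

    shear : ∀ x → Carrier → Carrier
    shear x y = x ⊕ ω ⊗ y

    unshear : ∀ x → Carrier → Carrier
    unshear x u = ω̄ ⊗ (u ⊕ x)

    shear-unshear : ∀ x u → shear x (unshear x u) ≈ u
    shear-unshear x u = begin
      x ⊕ ω ⊗ (ω̄ ⊗ (u ⊕ x))
        ≈⟨ solve 4 (λ ω ω̄ x u → x :+ ω :* (ω̄ :* (u :+ x)) := (ω :* ω̄) :* (u :+ x) :+ x) ≈-refl ω ω̄ x u ⟩
      (ω ⊗ ω̄) ⊗ (u ⊕ x) ⊕ x
        ≈⟨ +-congʳ (≈-trans (*-congʳ ω⊗ω̄≈1) (*-identityˡ _)) ⟩
      u ⊕ x ⊕ x
        ≈⟨ ⊕-cancelʳ u x ⟩
      u ∎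

    unshear-shear : ∀ x y → unshear x (shear x y) ≈ y
    unshear-shear x y = begin
      ω̄ ⊗ (x ⊕ ω ⊗ y ⊕ x)
        ≈⟨ *-congˡ (≈-trans (+-congʳ (+-comm x (ω ⊗ y))) (⊕-cancelʳ (ω ⊗ y) x)) ⟩
      ω̄ ⊗ (ω ⊗ y)
        ≈⟨ solve 3 (λ ω ω̄ y → ω̄ :* (ω :* y) := (ω :* ω̄) :* y) ≈-refl ω ω̄ y ⟩
      (ω ⊗ ω̄) ⊗ y
        ≈⟨ ≈-trans (*-congʳ ω⊗ω̄≈1) (*-identityˡ y) ⟩
      y ∎

    -- Q x y = (x + ω y)(x + ω̄ y), which in the coordinate u = shear x y becomes Q-factored x u.
    Q-factored : Carrier → Carrier → Carrier
    Q-factored x u = u ⊗ (ω̄ ⊗ x ⊕ ω ⊗ u)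

    Q-unshear : ∀ x u → Q x (unshear x u) ≈ Q-factored x u
    Q-unshear x u = begin
      Q x (ω̄ ⊗ (u ⊕ x))
        ≈⟨ cancel-doubles 0# (x ⊗ x ⊗ ω̄ ⊕ u ⊗ x ⊗ ω̄ ⊗ ω̄) (solve 3 (λ ω x u →
             x :* x :+ x :* ((ω :+ con 1) :* (u :+ x)) :+ ((ω :+ con 1) :* (u :+ x)) :* ((ω :+ con 1) :* (u :+ x))
               :+ (con 1 :+ con 1) :* con 0
           := u :* ((ω :+ con 1) :* x :+ ω :* u) :+ (x :* x :+ u :* u) :* (ω :* ω :+ ω :+ con 1)
               :+ (con 1 :+ con 1) :* (x :* x :* (ω :+ con 1) :+ u :* x :* (ω :+ con 1) :* (ω :+ con 1))) ≈-refl ω x u) ⟩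
      u ⊗ (ω̄ ⊗ x ⊕ ω ⊗ u) ⊕ (x ⊗ x ⊕ u ⊗ u) ⊗ (ω ⊗ ω ⊕ ω ⊕ 1#)
        ≈⟨ +-congˡ (≈-trans (*-congˡ ω-root) (zeroʳ _)) ⟩
      u ⊗ (ω̄ ⊗ x ⊕ ω ⊗ u) ⊕ 0#      ≈⟨ +-identityʳ _ ⟩
      u ⊗ (ω̄ ⊗ x ⊕ ω ⊗ u) ∎

    Q-factored-solution : ∀ t {u v} → u ⊗ v ≈ 1# → Q-factored (ω ⊗ (t ⊗ v ⊕ ω ⊗ u)) u ≈ t
    Q-factored-solution t {u} {v} u⊗v≈1 = begin
      u ⊗ (ω̄ ⊗ (ω ⊗ (t ⊗ v ⊕ ω ⊗ u)) ⊕ ω ⊗ u)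
        ≈⟨ solve 5 (λ ω ω̄ t u v → u :* (ω̄ :* (ω :* (t :* v :+ ω :* u)) :+ ω :* u)
                               := u :* ((ω :* ω̄) :* (t :* v :+ ω :* u) :+ ω :* u)) ≈-refl ω ω̄ t u v ⟩
      u ⊗ ((ω ⊗ ω̄) ⊗ (t ⊗ v ⊕ ω ⊗ u) ⊕ ω ⊗ u)
        ≈⟨ *-congˡ (+-congʳ (≈-trans (*-congʳ ω⊗ω̄≈1) (*-identityˡ _))) ⟩
      u ⊗ (t ⊗ v ⊕ ω ⊗ u ⊕ ω ⊗ u)    ≈⟨ *-congˡ (⊕-cancelʳ (t ⊗ v) (ω ⊗ u)) ⟩
      u ⊗ (t ⊗ v)                    ≈⟨ solve 3 (λ t u v → u :* (t :* v) := t :* (u :* v)) ≈-refl t u v ⟩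
      t ⊗ (u ⊗ v)                    ≈⟨ ≈-trans (*-congˡ u⊗v≈1) (*-identityʳ t) ⟩
      t ∎

module FiniteFieldProperties (F : FiniteField) where

  open FiniteField F
    renaming (_+_ to _⊕_; _*_ to _⊗_; -_ to ⊖_; refl to ≈-refl; sym to ≈-sym; trans to ≈-trans)
  open Counting isEquivalence _≟_ enum enum-inj enum-surj
  open import Algebra.Properties.Ring ring using (-‿involutive; -0#≈0#)
  open import Algebra.Solver.Ring.NaturalCoefficients.Default commutativeSemiring
  module ≈-Reasoning = Relation.Binary.Reasoning.Setoid setoid

  zero-product : ∀ {a b} → a ⊗ b ≈ 0# → a ≈ 0# ⊎ b ≈ 0#
  zero-product {a} {b} a⊗b≈0 with a ≟ 0#
  ... | yes a≈0 = inj₁ a≈0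
  ... | no a≉0 with inverse a a≉0
  ...   | a′ , a⊗a′≈1 = inj₂ (begin
    b                ≈⟨ *-identityˡ b ⟨
    1# ⊗ b           ≈⟨ *-congʳ (≈-trans (*-comm a′ a) a⊗a′≈1) ⟨
    a′ ⊗ a ⊗ b       ≈⟨ *-assoc a′ a b ⟩
    a′ ⊗ (a ⊗ b)     ≈⟨ *-congˡ a⊗b≈0 ⟩
    a′ ⊗ 0#          ≈⟨ zeroʳ a′ ⟩
    0# ∎)
    where open ≈-Reasoning

  ≉0-of-inverse : ∀ {a b} → a ⊗ b ≈ 1# → ¬ a ≈ 0#
  ≉0-of-inverse {a} {b} a⊗b≈1 a≈0 = 0≉1 (≈-trans (≈-sym (zeroˡ b)) (≈-trans (*-congʳ (≈-sym a≈0)) a⊗b≈1))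

  _⁻¹ : Carrier → Carrier
  x ⁻¹ with x ≟ 0#
  ... | yes _  = 0#
  ... | no x≉0 = proj₁ (inverse x x≉0)

  ⁻¹-inverseʳ : ∀ {x} → ¬ x ≈ 0# → x ⊗ x ⁻¹ ≈ 1#
  ⁻¹-inverseʳ {x} x≉0 with x ≟ 0#
  ... | yes x≈0 = ⊥-elim (x≉0 x≈0)
  ... | no x≉0′ = proj₂ (inverse x x≉0′)

  ⁻¹-zero : ∀ {x} → x ≈ 0# → x ⁻¹ ≈ 0#
  ⁻¹-zero {x} x≈0 with x ≟ 0#
  ... | yes _   = ≈-refl
  ... | no x≉0 = ⊥-elim (x≉0 x≈0)

  ⁻¹-unique : ∀ {x y} → x ⊗ y ≈ 1# → x ⁻¹ ≈ y
  ⁻¹-unique {x} {y} x⊗y≈1 = begin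
    x ⁻¹                 ≈⟨ *-identityʳ (x ⁻¹) ⟨
    x ⁻¹ ⊗ 1#            ≈⟨ *-congˡ x⊗y≈1 ⟨
    x ⁻¹ ⊗ (x ⊗ y)       ≈⟨ *-assoc (x ⁻¹) x y ⟨
    x ⁻¹ ⊗ x ⊗ y         ≈⟨ *-congʳ (≈-trans (*-comm (x ⁻¹) x) (⁻¹-inverseʳ (≉0-of-inverse x⊗y≈1))) ⟩
    1# ⊗ y               ≈⟨ *-identityˡ y ⟩
    y ∎
    where open ≈-Reasoning

  ⁻¹-cong : ∀ {x y} → x ≈ y → x ⁻¹ ≈ y ⁻¹
  ⁻¹-cong {x} {y} x≈y = by-cases (x ≟ 0#)
    where
    by-cases : Dec (x ≈ 0#) → x ⁻¹ ≈ y ⁻¹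
    by-cases (yes x≈0) = ≈-trans (⁻¹-zero x≈0) (≈-sym (⁻¹-zero (≈-trans (≈-sym x≈y) x≈0)))
    by-cases (no x≉0)  = ≈-sym (⁻¹-unique (≈-trans (*-congʳ (≈-sym x≈y)) (⁻¹-inverseʳ x≉0)))

  ⁻¹-involutive : ∀ x → x ⁻¹ ⁻¹ ≈ x
  ⁻¹-involutive x = by-cases (x ≟ 0#)
    where
    by-cases : Dec (x ≈ 0#) → x ⁻¹ ⁻¹ ≈ x
    by-cases (yes x≈0) = ≈-trans (⁻¹-zero (⁻¹-zero x≈0)) (≈-sym x≈0)
    by-cases (no x≉0)  = ⁻¹-unique (≈-trans (*-comm (x ⁻¹) x) (⁻¹-inverseʳ x≉0))

  size-odd : ¬ HasCharacteristicTwo commRing → ∃ λ m → m + m + 1 ≡ size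
  size-odd 1+1≉0 = proj₁ pairing , trans (cong (_+ 1) (sym (proj₂ pairing))) (count-≉ 0#)
    where
    ≉0-resp : (λ x → ¬ x ≈ 0#) Respects _≈_
    ≉0-resp x≈y x≉0 y≈0 = x≉0 (≈-trans x≈y y≈0)
    ⊖-≉0 : ∀ {x} → ¬ x ≈ 0# → ¬ ⊖ x ≈ 0#
    ⊖-≉0 {x} x≉0 ⊖x≈0 = x≉0 (≈-trans (≈-sym (-‿involutive x)) (≈-trans (-‿cong ⊖x≈0) -0#≈0#))
    ⊖-fixless : ∀ {x} → ¬ x ≈ 0# → ¬ ⊖ x ≈ x
    ⊖-fixless {x} x≉0 ⊖x≈x with zero-product {1# ⊕ 1#} {x} (begin
      (1# ⊕ 1#) ⊗ x        ≈⟨ distribʳ x 1# 1# ⟩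
      1# ⊗ x ⊕ 1# ⊗ x      ≈⟨ +-cong (*-identityˡ x) (≈-trans (*-identityˡ x) (≈-sym ⊖x≈x)) ⟩
      x ⊕ ⊖ x              ≈⟨ -‿inverseʳ x ⟩
      0# ∎)
      where open ≈-Reasoning
    ... | inj₁ 1+1≈0 = 1+1≉0 1+1≈0
    ... | inj₂ x≈0   = x≉0 x≈0
    pairing : ∃ λ m → count (λ x → ¬? (x ≟ 0#)) ≡ m + m
    pairing = count-even-by-involution (λ x → ¬? (x ≟ 0#)) ≉0-resp ⊖_ -‿cong ⊖-≉0 ⊖-fixless -‿involutive

  characteristic-two : ∀ k → size ≡ 4 ^ k → HasCharacteristicTwo commRing
  characteristic-two zero size≡1 = ⊥-elim (0≉1 (index-injective (Fin-1-unique size≡1 (index 0#) (index 1#))))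
    where
    Fin-1-unique : ∀ {m} → m ≡ 1 → (i j : Fin m) → i ≡ j
    Fin-1-unique refl zero zero = refl
  characteristic-two (suc k) size≡ with (1# ⊕ 1#) ≟ 0#
  ... | yes 1+1≈0 = 1+1≈0
  ... | no 1+1≉0  = ⊥-elim (odd≢4^suc (proj₁ (size-odd 1+1≉0)) k (trans (proj₂ (size-odd 1+1≉0)) size≡))

  module _ (char₂ : HasCharacteristicTwo commRing) where

    open CharacteristicTwo commRing char₂

    σ σ⁻ : Carrier → Carrier
    σ z  = (z ⊕ 1#) ⁻¹
    σ⁻ w = w ⁻¹ ⊕ 1#

    σ-cong : Congruent _≈_ _≈_ σ
    σ-cong z≈z′ = ⁻¹-cong (+-congʳ z≈z′)

    σ⁻-cong : Congruent _≈_ _≈_ σ⁻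
    σ⁻-cong w≈w′ = +-congʳ (⁻¹-cong w≈w′)

    σ-σ⁻ : ∀ w → σ (σ⁻ w) ≈ w
    σ-σ⁻ w = ≈-trans (⁻¹-cong (⊕-cancelʳ (w ⁻¹) 1#)) (⁻¹-involutive w)

    σ⁻-σ : ∀ z → σ⁻ (σ z) ≈ z
    σ⁻-σ z = ≈-trans (+-congʳ (⁻¹-involutive (z ⊕ 1#))) (⊕-cancelʳ z 1#)

    σ-inverseʳ : ∀ {z} → ¬ z ≈ 1# → (z ⊕ 1#) ⊗ σ z ≈ 1#
    σ-inverseʳ z≉1 = ⁻¹-inverseʳ (z≉1 ∘ ⊕≈0⇒≈)

    Outside01 : Pred Carrier 0ℓ
    Outside01 z = ¬ z ≈ 0# × ¬ z ≈ 1#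

    outside01? : Pred.Decidable Outside01
    outside01? z = ¬? (z ≟ 0#) ×-dec ¬? (z ≟ 1#)

    outside01-resp : Outside01 Respects _≈_
    outside01-resp z≈z′ (z≉0 , z≉1) = z≉0 ∘ ≈-trans z≈z′ , z≉1 ∘ ≈-trans z≈z′

    outside01-σ : ∀ {z} → Outside01 z → Outside01 (σ z)
    outside01-σ {z} (z≉0 , z≉1) = σz≉0 , σz≉1
      where
      σz≉0 : ¬ σ z ≈ 0#
      σz≉0 = ≉0-of-inverse (≈-trans (*-comm (σ z) (z ⊕ 1#)) (σ-inverseʳ z≉1))
      σz≉1 : ¬ σ z ≈ 1#
      σz≉1 σz≈1 = z≉0 (≈-trans (≈-sym (⊕-cancelʳ z 1#)) (≈-trans (+-congʳ z⊕1≈1) (x⊕x≈0 1#)))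
        where
        z⊕1≈1 : z ⊕ 1# ≈ 1#
        z⊕1≈1 = ≈-trans (≈-sym (*-identityʳ (z ⊕ 1#))) (≈-trans (*-congˡ (≈-sym σz≈1)) (σ-inverseʳ z≉1))

    outside01-σ⁻ : ∀ {z} → Outside01 (σ z) → Outside01 z
    outside01-σ⁻ {z} (σz≉0 , σz≉1) = z≉0 , z≉1
      where
      z≉0 : ¬ z ≈ 0#
      z≉0 z≈0 = σz≉1 (≈-trans (⁻¹-cong (≈-trans (+-congʳ z≈0) (+-identityˡ 1#))) (⁻¹-unique (*-identityˡ 1#)))
      z≉1 : ¬ z ≈ 1#
      z≉1 z≈1 = σz≉0 (⁻¹-zero (≈-trans (+-congʳ z≈1) char₂))

    σ³ : ∀ {z} → Outside01 z → σ (σ (σ z)) ≈ z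
    σ³ {z} (z≉0 , z≉1) = ⁻¹-unique (begin
      (σ (σ z) ⊕ 1#) ⊗ z
        ≈⟨ *-congʳ (+-congʳ σ²) ⟩
      ((z ⊕ 1#) ⊗ z ⁻¹ ⊕ 1#) ⊗ z
        ≈⟨ solve 3 (λ a z v → (a :* v :+ con 1) :* z := a :* (z :* v) :+ z) ≈-refl (z ⊕ 1#) z (z ⁻¹) ⟩
      (z ⊕ 1#) ⊗ (z ⊗ z ⁻¹) ⊕ z
        ≈⟨ +-congʳ (*-congˡ (⁻¹-inverseʳ z≉0)) ⟩
      (z ⊕ 1#) ⊗ 1# ⊕ z
        ≈⟨ +-congʳ (*-identityʳ (z ⊕ 1#)) ⟩
      z ⊕ 1# ⊕ z
        ≈⟨ ≈-trans (+-congʳ (+-comm z 1#)) (⊕-cancelʳ 1# z) ⟩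
      1# ∎)
      where
      open ≈-Reasoning
      σ² : σ (σ z) ≈ (z ⊕ 1#) ⊗ z ⁻¹
      σ² = ⁻¹-unique (begin
        (σ z ⊕ 1#) ⊗ ((z ⊕ 1#) ⊗ z ⁻¹)
          ≈⟨ solve 3 (λ s a v → (s :+ con 1) :* (a :* v) := (a :* s :+ a) :* v) ≈-refl (σ z) (z ⊕ 1#) (z ⁻¹) ⟩
        ((z ⊕ 1#) ⊗ σ z ⊕ (z ⊕ 1#)) ⊗ z ⁻¹
          ≈⟨ *-congʳ (+-congʳ (σ-inverseʳ z≉1)) ⟩
        (1# ⊕ (z ⊕ 1#)) ⊗ z ⁻¹
          ≈⟨ *-congʳ (≈-trans (+-comm 1# (z ⊕ 1#)) (⊕-cancelʳ z 1#)) ⟩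
        z ⊗ z ⁻¹
          ≈⟨ ⁻¹-inverseʳ z≉0 ⟩
        1# ∎)

    σ-fixed-point : ∀ {z} → ¬ z ≈ 1# → σ z ≈ z → IsPrimitiveCubeRoot commRing z
    σ-fixed-point {z} z≉1 σz≈z = ≈⇒⊕≈0 (begin
      z ⊗ z ⊕ z           ≈⟨ solve 1 (λ z → z :* z :+ z := (z :+ con 1) :* z) ≈-refl z ⟩
      (z ⊕ 1#) ⊗ z        ≈⟨ *-congˡ σz≈z ⟨
      (z ⊕ 1#) ⊗ σ z      ≈⟨ σ-inverseʳ z≉1 ⟩
      1# ∎)
      where open ≈-Reasoning

    IsCubeRootCoordinates : Pred Carrier 0ℓ
    IsCubeRootCoordinates ω = ω ⊗ ω ⊕ ω ⊕ 1# ≈ 0#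

    size-2-mod-3 : (∀ ω → ¬ IsCubeRootCoordinates ω) → ∃ λ m → m + m + m + 2 ≡ size
    size-2-mod-3 no-root = proj₁ triples , trans (cong (_+ 2) (sym (proj₂ triples))) (count-≉₂ 0≉1)
      where
      triples : ∃ λ m → count outside01? ≡ m + m + m
      triples = count-triple-by-order-three outside01? outside01-resp σ σ-cong outside01-σ
                  (λ {z} generic σz≈z → no-root z (σ-fixed-point (proj₂ generic) σz≈z))
                  outside01-σ⁻ σ³ σ⁻ σ⁻-cong σ-σ⁻ σ⁻-σ

    primitive-cube-root : ∀ k → size ≡ 4 ^ k → ∃ IsCubeRootCoordinates
    primitive-cube-root k size≡ with Fin.any? (λ i → (enum i ⊗ enum i ⊕ enum i ⊕ 1#) ≟ 0#)
    ... | yes (i , root) = enum i , root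
    ... | no ∄root       = ⊥-elim (2+3m≢4^k (proj₁ 2mod3) k (trans (proj₂ 2mod3) size≡))
      where
      2mod3 : ∃ λ m → m + m + m + 2 ≡ size
      2mod3 = size-2-mod-3 λ ω root →
        ∄root (index ω , ≈-trans (+-congʳ (+-cong (*-cong (enum-index ω) (enum-index ω)) (enum-index ω))) root)

    square-injective : ∀ {x y} → x ⊗ x ≈ y ⊗ y → x ≈ y
    square-injective {x} {y} x²≈y² with zero-product (≈-trans (square-⊕ x y) (≈⇒⊕≈0 x²≈y²))
    ... | inj₁ x⊕y≈0 = ⊕≈0⇒≈ x⊕y≈0
    ... | inj₂ x⊕y≈0 = ⊕≈0⇒≈ x⊕y≈0

    module _ (t : Carrier) where

      h : Carrier → Carrier
      h x = cube F x ⊕ t ⊗ x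

      h-cong : Congruent _≈_ _≈_ h
      h-cong x≈y = +-cong (*-cong (*-cong x≈y x≈y) x≈y) (*-congˡ x≈y)

      Q≈t⇒h≈h : ∀ {x y} → Q x y ≈ t → h x ≈ h y
      Q≈t⇒h≈h {x} {y} Q≈t =
        ⊕≈0⇒≈ (≈-trans (cubic-difference t x y) (≈-trans (*-congˡ (≈⇒⊕≈0 Q≈t)) (zeroʳ (x ⊕ y))))

      h≈h⇒Q≈t : ∀ {x y} → h x ≈ h y → ¬ x ≈ y → Q x y ≈ t
      h≈h⇒Q≈t {x} {y} hx≈hy x≉y with zero-product (≈-trans (≈-sym (cubic-difference t x y)) (≈⇒⊕≈0 hx≈hy))
      ... | inj₁ x⊕y≈0 = ⊥-elim (x≉y (⊕≈0⇒≈ x⊕y≈0))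
      ... | inj₂ Q⊕t≈0 = ⊕≈0⇒≈ Q⊕t≈0

      fibreSize≤3 : ∀ y → fibreSize h y ≤ 3
      fibreSize≤3 y with Fin.any? (λ i → (h y ≟ h (enum i)) ×-dec ¬? (enum i ≟ y))
      ... | no ∄other = count-≤3 (λ z → h y ≟ h z) {y} {y} {y} (inj₁ ∘ only-y)
        where
        only-y : ∀ {z} → h y ≈ h z → z ≈ y
        only-y {z} hy≈hz with z ≟ y
        ... | yes z≈y = z≈y
        ... | no z≉y  = ⊥-elim (∄other (index z , ≈-trans hy≈hz (h-cong (≈-sym (enum-index z)))
                                                , z≉y ∘ ≈-trans (≈-sym (enum-index z))))
      ... | yes (i , hy≈hr , r≉y) = count-≤3 (λ z → h y ≟ h z) {y} {enum i} {enum i ⊕ y} cover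
        where
        r : Carrier
        r = enum i
        cover : ∀ {z} → h y ≈ h z → z ≈ y ⊎ z ≈ r ⊎ z ≈ r ⊕ y
        cover {z} hy≈hz with z ≟ y
        ... | yes z≈y = inj₁ z≈y
        ... | no z≉y with zero-product (begin
          (z ⊕ r) ⊗ (z ⊕ r ⊕ y)    ≈⟨ Q-difference y z r ⟨
          Q z y ⊕ Q r y            ≈⟨ +-cong (h≈h⇒Q≈t (≈-sym hy≈hz) z≉y) (h≈h⇒Q≈t (≈-sym hy≈hr) r≉y) ⟩
          t ⊕ t                    ≈⟨ x⊕x≈0 t ⟩
          0# ∎)
          where open ≈-Reasoning
        ...   | inj₁ z⊕r≈0   = inj₂ (inj₁ (⊕≈0⇒≈ z⊕r≈0))
        ...   | inj₂ z⊕r⊕y≈0 = inj₂ (inj₂ (⊕≈0⇒≈ (≈-trans (≈-sym (+-assoc z r y)) z⊕r⊕y≈0)))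

      image-size-bound : 3 * imageSize F t + ∑ (fibreSize h) ≤ 4 * size
      image-size-bound = begin
        3 * imageSize F t + ∑ (fibreSize h)
          ≡⟨ cong (λ i → 3 * i + ∑ (fibreSize h)) (length-filter-tabulate (inImage? F t) id) ⟩
        3 * count image? + ∑ (fibreSize h)
          ≤⟨ image-bound h h-cong image? image⊆ fibreSize≤3 ⟩
        4 * size ∎
        where
        open ≤-Reasoning
        image? : Pred.Decidable (λ b → Any (λ j → b ≈ h (enum j)) (allFin size))
        image? b = any? (λ j → b ≟ h (enum j)) (allFin size)
        image⊆ : ∀ {b} → Any (λ j → b ≈ h (enum j)) (allFin size) → ∃ λ a → b ≈ h a
        image⊆ b∈image = enum (proj₁ (satisfied b∈image)) , proj₂ (satisfied b∈image)

      module _ {ω} (ω-root : IsCubeRootCoordinates ω) where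

        open CubeRootCoordinates ω ω-root

        Q-solution-count : size ≤ ∑[ x ] count (λ y → Q x y ≟ t) + 1
        Q-solution-count = begin
          size
            ≡⟨ count-≉ 0# ⟨
          count (λ u → ¬? (u ≟ 0#)) + 1
            ≤⟨ +-monoˡ-≤ 1 (∑-mono-≤ solvable) ⟩
          ∑[ u ] ∑[ x ] 𝟙 (Q-factored x u ≟ t) + 1
            ≡⟨ cong (_+ 1) (∑-swap (λ x u → 𝟙 (Q-factored x u ≟ t))) ⟨
          ∑[ x ] ∑[ u ] 𝟙 (Q-factored x u ≟ t) + 1
            ≡⟨ cong (_+ 1) (∑-cong substitute) ⟨
          ∑[ x ] count (λ y → Q x y ≟ t) + 1 ∎
          where
          open ≤-Reasoning
          substitute : ∀ x → count (λ y → Q x y ≟ t) ≡ ∑[ u ] 𝟙 (Q-factored x u ≟ t)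
          substitute x =
            trans (∑-reindex (unshear x) (shear x) (λ u≈ → *-congˡ (+-congʳ u≈)) (λ y≈ → +-congˡ (*-congˡ y≈))
                             (unshear-shear x) (shear-unshear x)
                             (λ y → 𝟙 (Q x y ≟ t))
                             (λ {y} {y′} y≈y′ → 𝟙-cong (≈-trans (Q-cong ≈-refl (≈-sym y≈y′)))
                                                       (≈-trans (Q-cong ≈-refl y≈y′)) (Q x y ≟ t) (Q x y′ ≟ t)))
                  (∑-cong λ u → 𝟙-cong (≈-trans (≈-sym (Q-unshear x u))) (≈-trans (Q-unshear x u))
                                        (Q x (unshear x u) ≟ t) (Q-factored x u ≟ t))
          solvable : ∀ u → 𝟙 (¬? (u ≟ 0#)) ≤ ∑[ x ] 𝟙 (Q-factored x u ≟ t)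
          solvable u with u ≟ 0#
          ... | yes _  = z≤n
          ... | no u≉0 = count-≥1 (λ x → Q-factored x u ≟ t)
                                  (λ x≈x′ → ≈-trans (*-congˡ (+-congʳ (*-congˡ (≈-sym x≈x′)))))
                                  (Q-factored-solution t (proj₂ (inverse u u≉0)))

        fibre-sum-bound : 2 * size ≤ ∑ (fibreSize h) + 2
        fibre-sum-bound = begin
          2 * size
            ≡⟨ cong (size +_) (ℕ.+-identityʳ size) ⟩
          size + size
            ≤⟨ +-monoʳ-≤ size Q-solution-count ⟩
          size + (∑[ x ] count (λ y → Q x y ≟ t) + 1)
            ≡⟨ ℕ.+-assoc size _ 1 ⟨
          size + ∑[ x ] count (λ y → Q x y ≟ t) + 1
            ≤⟨ +-monoˡ-≤ 1 pairs ⟩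
          ∑ (fibreSize h) + count square? + 1
            ≡⟨ ℕ.+-assoc (∑ (fibreSize h)) _ 1 ⟩
          ∑ (fibreSize h) + (count square? + 1)
            ≤⟨ +-monoʳ-≤ (∑ (fibreSize h)) (+-monoˡ-≤ 1 square-roots≤1) ⟩
          ∑ (fibreSize h) + 2 ∎
          where
          open ≤-Reasoning
          square? : Pred.Decidable (λ x → x ⊗ x ≈ t)
          square? x = (x ⊗ x) ≟ t
          square-roots≤1 : count square? ≤ 1
          square-roots≤1 = count-≤1 square? (λ x²≈t y²≈t → square-injective (≈-trans x²≈t (≈-sym y²≈t)))
          pairs : size + ∑[ x ] count (λ y → Q x y ≟ t) ≤ ∑ (fibreSize h) + count square?
          pairs = pair-bound (λ x y → h x ≟ h y) (λ x y → Q x y ≟ t) square?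
                    (λ y≈x → h-cong (≈-sym y≈x)) Q≈t⇒h≈h
                    (λ {x} y≈x Q≈t → ≈-trans (≈-sym (Q-diagonal x)) (≈-trans (Q-cong ≈-refl (≈-sym y≈x)) Q≈t))

proposition1 : (F : FiniteField) (k : ℕ) → FiniteField.size F ≡ 2 ^ (2 * k) →
    ∀ (t : FiniteField.Carrier F) → 3 * imageSize F t ≤ 2 * FiniteField.size F + 1
proposition1 F k size≡2^2k t =
  image-size-arithmetic (imageSize F t) (image-size-bound char₂ t) (fibre-sum-bound char₂ t (proj₂ ω))
                        (proj₁ (4^k≡1+m*3 k) , trans size≡4^k (proj₂ (4^k≡1+m*3 k)))
  where
  open FiniteFieldProperties F
  size≡4^k : FiniteField.size F ≡ 4 ^ k
  size≡4^k = trans size≡2^2k (sym (ℕ.^-*-assoc 2 2 k))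
  char₂ : HasCharacteristicTwo (FiniteField.commRing F)
  char₂ = characteristic-two k size≡4^k
  ω : ∃ (IsCubeRootCoordinates char₂)
  ω = primitive-cube-root char₂ k size≡4^k
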